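{- Let $T$ be an $(r\times c, v)$-near triple array with $v\ge rc - c\cdot\min(r,c-1)/2$. Then for each integer $i$ with $0 < i \le rc - v$ there exists an $(r\times c, v+i)$-near triple array.
   Context: An $r\times c$ row-column design on $v$ symbols is an $r\times c$ array each of whose cells is filled with one of $v$ symbols. It is binary if no symbol occurs more than once in any row or in any column. Let $e=rc/v$, $e^-=\lfloor e\rfloor$, $e^+=\lceil e\rceil$. The design is equireplicate if $e$ is an integer and every symbol occurs exactly $e$ times, and near equireplicate if $e$ is not an integer and every symbol occurs $e^-$ or $e^+$ times. For a binary design with $r,c\ge2$, let $R_i$, $C_j$ be the symbol sets of row $i$ and column $j$, and put $\lambda_{rc}=\frac{1}{rc}\sum_{i,j}|R_i\cap C_j|$, $\lambda_{rr}=\binom{r}{2}^{ -1}\sum_{i<j}|R_i\cap R_j|$, $\lambda_{cc}=\binom{c}{2}^{ -1}\sum_{i<j}|C_i\cap C_j|$; for real $x$, $x^-=\lfloor x\rfloor$, $x^+=\lceil x\rceil$. An $(r\times c,v)$-near triple array is a binary $r\times c$ row-column design on $v$ symbols which is equireplicate or near equireplicate and in which every row and column share $\lambda_{rc}^-$ or $\lambda_{rc}^+$ symbols, every two distinct rows share $\lambda_{rr}^-$ or $\lambda_{rr}^+$ symbols, and every two distinct columns share $\lambda_{cc}^-$ or $\lambda_{cc}^+$ symbols. -}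

module Defs where

open import Data.Nat using (ℕ; _+_; _*_; _∸_; _≤_; _<_; _<ᵇ_)
open import Data.Fin using (Fin; toℕ; zero; suc)
open import Data.Fin.Subset using (Subset; ⁅_⁆; ⋃; _∩_; ∣_∣)
open import Data.List using (map; allFin)
open import Data.Bool using (if_then_else_)
open import Data.Product using (_×_; Σ)
open import Data.Sum using (_⊎_)
open import Relation.Binary.PropositionalEquality using (_≡_)
open import Relation.Nullary.Decidable using (⌊_⌋)
open import Data.Fin using (_≟_)
open import Data.Nat.Combinatorics using (_C_)

sumFin : (n : ℕ) → (Fin n → ℕ) → ℕ
sumFin ℕ.zero    f = 0
sumFin (ℕ.suc n) f = f zero + sumFin n (λ i → f (suc i))

sumPairs : (n : ℕ) → (Fin n → Fin n → ℕ) → ℕ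
sumPairs n f = sumFin n (λ i → sumFin n (λ j → if toℕ i <ᵇ toℕ j then f i j else 0))

-- x = ⌊ S / N ⌋  (for N > 0)
IsFloor : ℕ → ℕ → ℕ → Set
IsFloor S N x = x * N ≤ S × S < x * N + N

-- x = ⌈ S / N ⌉  (for N > 0):  x - 1 < S/N ≤ x
IsCeil : ℕ → ℕ → ℕ → Set
IsCeil S N x = S ≤ x * N × x * N < S + N

FloorOrCeil : ℕ → ℕ → ℕ → Set
FloorOrCeil S N x = IsFloor S N x ⊎ IsCeil S N x

Design : ℕ → ℕ → ℕ → Set
Design r c v = Fin r → Fin c → Fin v

module _ {r c v : ℕ} (A : Design r c v) where

  Binary : Set
  Binary = (∀ i j j' → A i j ≡ A i j' → j ≡ j')
         × (∀ j i i' → A i j ≡ A i' j → i ≡ i')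

  occ : Fin v → ℕ
  occ s = sumFin r (λ i → sumFin c (λ j → if ⌊ A i j ≟ s ⌋ then 1 else 0))

  rowSet : Fin r → Subset v
  rowSet i = ⋃ (map (λ j → ⁅ A i j ⁆) (allFin c))

  colSet : Fin c → Subset v
  colSet j = ⋃ (map (λ i → ⁅ A i j ⁆) (allFin r))

  -- numerators of λ_rc, λ_rr, λ_cc (denominators rc, C(r,2), C(c,2))
  Src : ℕ
  Src = sumFin r (λ i → sumFin c (λ j → ∣ rowSet i ∩ colSet j ∣))

  Srr : ℕ
  Srr = sumPairs r (λ i i' → ∣ rowSet i ∩ rowSet i' ∣)

  Scc : ℕ
  Scc = sumPairs c (λ j j' → ∣ colSet j ∩ colSet j' ∣)

  IsNearTripleArray : Set
  IsNearTripleArray =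
      2 ≤ r × 2 ≤ c
    × Binary
    × (∀ s → FloorOrCeil (r * c) v (occ s))
    × (∀ i j → FloorOrCeil Src (r * c) ∣ rowSet i ∩ colSet j ∣)
    × (∀ i i' → toℕ i < toℕ i' → FloorOrCeil Srr (r C 2) ∣ rowSet i ∩ rowSet i' ∣)
    × (∀ j j' → toℕ j < toℕ j' → FloorOrCeil Scc (c C 2) ∣ colSet j ∩ colSet j' ∣)

NearTripleArray : ℕ → ℕ → ℕ → Set
NearTripleArray r c v = Σ (Design r c v) IsNearTripleArray

-- The hypothesis gives v < rc ≤ 2v and rc ≤ v + C(c,2), so every symbol occurs once or twice.
-- Double counting gives Σ_{i,j} |R_i ∩ C_j| ≤ Σ_s occ(s)² ≤ 2rc and
-- Σ_{j<j′} |C_j ∩ C_j′| ≤ Σ_s C(occ(s),2) = rc − v ≤ C(c,2); since each intersection size is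
-- the floor or ceiling of its average, a row meets a column in at most two symbols and two
-- columns share at most one.  Now take rows p < q with the largest intersection (nonempty by
-- pigeonhole), a common symbol s = A q k, and replace that entry by a new symbol.  Occurrences
-- stay in {1, 2}, no row–column or column–column intersection grows, |R_p ∩ R_q| drops by
-- one, and every other row intersection is unchanged because s occurs only in rows p and q.
-- So each family of intersection sizes still takes two consecutive values, and such values
-- are always the floor or ceiling of their average.  Repeating this adds the i new symbols.

module Submission where

open import Defs
open import Data.Nat
  using (ℕ; zero; suc; _+_; _*_; _∸_; _≤_; _<_; _⊓_; _<ᵇ_; z≤n; s≤s; z<s; >-nonZero; _≤′_; ≤′-refl; ≤′-step)
open import Data.Nat.Properties hiding (_≟_; suc-injective; <⇒≢)
open import Data.Nat.Combinatorics using (_C_; nC1≡n; nCk+nC[k+1]≡[n+1]C[k+1])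
open import Data.Nat.Tactic.RingSolver using (solve-∀)
open import Data.Fin using (Fin; zero; suc; toℕ; _≟_; remQuot; combine)
open import Data.Fin.Properties using (suc-injective; pigeonhole; combine-remQuot; toℕ-injective; <⇒≢)
open import Data.Fin.Subset
  using (Subset; inside; outside; _∈_; _∉_; _⊆_; _∩_; _∪_; _─_; _-_; ⁅_⁆; ⋃; ∣_∣; Nonempty)
open import Data.Fin.Subset.Properties
  using (⊆-antisym; ∩-comm; x∈p∩q⁺; x∈p∩q⁻; x∈p∪q⁺; x∈p∪q⁻; x∈⁅x⁆; x∈⁅y⁆⇒x≡y; ∉⊥; ∣⊥∣≡0;
         Empty-unique; nonempty?; p─⊥≡p; p─q⊆p; ∣p─q∣≤∣p∣; x∈p∧x≢y⇒x∈p-y; x∈p⇒∣p-x∣<∣p∣)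
open import Data.Vec using (_∷_; []; lookup; here; there)
open import Data.Vec.Properties using ([]=⇒lookup; lookup⇒[]=)
open import Data.List using (List; map; allFin; cartesianProduct) renaming ([] to []ᴸ; _∷_ to _∷ᴸ_)
open import Data.List.Properties using (map-cong)
open import Data.List.Extrema.Nat using (argmax; f[⊥]≤f[argmax]; f[xs]≤f[argmax])
open import Data.List.Relation.Unary.Any using (Any; satisfied)
import Data.List.Relation.Unary.Any as Any
import Data.List.Relation.Unary.All as All
open import Data.List.Relation.Unary.Any.Properties using (map⁺; map⁻)
open import Data.List.Membership.Propositional.Properties using (∈-allFin; ∈-cartesianProduct⁺)
open import Data.Bool using (true; false; if_then_else_; T)
open import Data.Unit using (⊤; tt)
open import Data.Empty using (⊥; ⊥-elim)
open import Data.Product using (_×_; _,_; proj₁; proj₂; ∃; ∃₂; uncurry)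
open import Data.Sum using (_⊎_; inj₁; inj₂; [_,_])
open import Function using (_∘_; Injective)
open import Relation.Binary using (Tri; tri<; tri≈; tri>)
open import Relation.Binary.PropositionalEquality hiding ([_])
open import Relation.Nullary using (¬_; Dec; yes; no; contradiction)
open import Relation.Nullary.Decidable using (⌊_⌋; isYes≗does; dec-true; dec-false)

private variable
  n m : ℕ
  f g : Fin n → ℕ
  x y : Fin n
  p q : Subset n

sum-cong : (∀ i → f i ≡ g i) → sumFin n f ≡ sumFin n g
sum-cong {zero}  f≗g = refl
sum-cong {suc n} f≗g = cong₂ _+_ (f≗g zero) (sum-cong (f≗g ∘ suc))

sum-mono : (∀ i → f i ≤ g i) → sumFin n f ≤ sumFin n g
sum-mono {zero}  f≤g = z≤n
sum-mono {suc n} f≤g = +-mono-≤ (f≤g zero) (sum-mono (f≤g ∘ suc))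

sum-mono-< : ∀ {i} → (∀ i → f i ≤ g i) → f i < g i → sumFin n f < sumFin n g
sum-mono-< {suc n} {i = zero}  f≤g fi<gi = +-mono-<-≤ fi<gi (sum-mono (f≤g ∘ suc))
sum-mono-< {suc n} {i = suc i} f≤g fi<gi = +-mono-≤-< (f≤g zero) (sum-mono-< (f≤g ∘ suc) fi<gi)

sum-const : ∀ n b → sumFin n (λ _ → b) ≡ n * b
sum-const zero    b = refl
sum-const (suc n) b = cong (b +_) (sum-const n b)

term≤sum : ∀ (f : Fin n → ℕ) i → f i ≤ sumFin n f
term≤sum f zero    = m≤m+n _ _
term≤sum f (suc i) = ≤-trans (term≤sum (f ∘ suc) i) (m≤n+m _ (f zero))

sum-zero : ∀ n → sumFin n (λ _ → 0) ≡ 0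
sum-zero n = trans (sum-const n 0) (*-zeroʳ n)

sum-+ : ∀ (f g : Fin n → ℕ) → sumFin n (λ i → f i + g i) ≡ sumFin n f + sumFin n g
sum-+ {zero}  f g = refl
sum-+ {suc n} f g = trans (cong (f zero + g zero +_) (sum-+ (f ∘ suc) (g ∘ suc)))
                          (+-assoc-comm (f zero) (g zero) _ _)
  where
  +-assoc-comm : ∀ a b c d → a + b + (c + d) ≡ a + c + (b + d)
  +-assoc-comm = solve-∀

sum-+-const : ∀ (f : Fin n → ℕ) b → sumFin n (λ i → f i + b) ≡ sumFin n f + n * b
sum-+-const {n} f b = trans (sum-+ f (λ _ → b)) (cong (sumFin n f +_) (sum-const n b))

sum-*ˡ : ∀ b (f : Fin n → ℕ) → sumFin n (λ i → b * f i) ≡ b * sumFin n f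
sum-*ˡ {zero}  b f = sym (*-zeroʳ b)
sum-*ˡ {suc n} b f = trans (cong (b * f zero +_) (sum-*ˡ b (f ∘ suc))) (sym (*-distribˡ-+ b (f zero) _))

sum-*-sum : ∀ (f : Fin n → ℕ) (g : Fin m → ℕ) →
            sumFin n (λ i → sumFin m (λ j → f i * g j)) ≡ sumFin n f * sumFin m g
sum-*-sum {m = m} f g = begin
  sumFin _ (λ i → sumFin m (λ j → f i * g j)) ≡⟨ sum-cong (λ i → sum-*ˡ (f i) g) ⟩
  sumFin _ (λ i → f i * sumFin m g)           ≡⟨ sum-cong (λ i → *-comm (f i) _) ⟩
  sumFin _ (λ i → sumFin m g * f i)           ≡⟨ sum-*ˡ (sumFin m g) f ⟩
  sumFin m g * sumFin _ f                     ≡⟨ *-comm (sumFin m g) _ ⟩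
  sumFin _ f * sumFin m g                     ∎
  where open ≡-Reasoning

sum-swap : ∀ (F : Fin n → Fin m → ℕ) →
           sumFin n (λ i → sumFin m (F i)) ≡ sumFin m (λ j → sumFin n (λ i → F i j))
sum-swap {zero}  {m} F = sym (sum-zero m)
sum-swap {suc n} {m} F = trans (cong (sumFin m (F zero) +_) (sum-swap (F ∘ suc)))
                               (sym (sum-+ (F zero) _))

sum-positive : 0 < sumFin n f → ∃ λ i → 0 < f i
sum-positive {suc n} {f} 0<Σ with f zero in eq
... | suc _ = zero , subst (0 <_) (sym eq) z<s
... | zero  = let (i , 0<fi) = sum-positive {f = f ∘ suc} 0<Σ in suc i , 0<fi

two-terms≤sum : ∀ (f : Fin n → ℕ) {i j} → i ≢ j → f i + f j ≤ sumFin n f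
two-terms≤sum f {zero}  {zero}  i≢j = contradiction refl i≢j
two-terms≤sum f {zero}  {suc j} i≢j = +-monoʳ-≤ (f zero) (term≤sum (f ∘ suc) j)
two-terms≤sum f {suc i} {zero}  i≢j =
  subst (_≤ sumFin _ f) (+-comm (f zero) _) (+-monoʳ-≤ (f zero) (term≤sum (f ∘ suc) i))
two-terms≤sum f {suc i} {suc j} i≢j = ≤-trans (two-terms≤sum (f ∘ suc) (i≢j ∘ cong suc)) (m≤n+m _ (f zero))

three-terms≤sum : ∀ (f : Fin n → ℕ) {i j k} → i ≢ j → i ≢ k → j ≢ k → f i + f j + f k ≤ sumFin n f
three-terms≤sum f {zero}  {zero}  {_}     i≢j _   _   = contradiction refl i≢j
three-terms≤sum f {zero}  {suc _} {zero}  _   i≢k _   = contradiction refl i≢k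
three-terms≤sum f {suc _} {zero}  {zero}  _   _   j≢k = contradiction refl j≢k
three-terms≤sum f {zero}  {suc j} {suc k} _   _   j≢k =
  subst (_≤ sumFin _ f) (sym (+-assoc (f zero) _ _))
    (+-monoʳ-≤ (f zero) (two-terms≤sum (f ∘ suc) (j≢k ∘ cong suc)))
three-terms≤sum f {suc i} {zero}  {suc k} _   i≢k _   =
  subst (_≤ sumFin _ f) (rearrange (f zero) (f (suc i)) (f (suc k)))
    (+-monoʳ-≤ (f zero) (two-terms≤sum (f ∘ suc) (i≢k ∘ cong suc)))
  where
  rearrange : ∀ a b c → a + (b + c) ≡ b + a + c
  rearrange = solve-∀
three-terms≤sum f {suc i} {suc j} {zero}  i≢j _   _   =
  subst (_≤ sumFin _ f) (+-comm (f zero) _)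
    (+-monoʳ-≤ (f zero) (two-terms≤sum (f ∘ suc) (i≢j ∘ cong suc)))
three-terms≤sum f {suc i} {suc j} {suc k} i≢j i≢k j≢k =
  ≤-trans (three-terms≤sum (f ∘ suc) (i≢j ∘ cong suc) (i≢k ∘ cong suc) (j≢k ∘ cong suc))
          (m≤n+m _ (f zero))

-- occ A s unfolds to sumFin r (λ i → sumFin c (λ j → δ (A i j) s)).
δ : Fin n → Fin n → ℕ
δ s t = if ⌊ s ≟ t ⌋ then 1 else 0

δ-≡ : ∀ {s t : Fin n} → s ≡ t → δ s t ≡ 1
δ-≡ {s = s} {t} s≡t = cong (if_then 1 else 0) (trans (isYes≗does (s ≟ t)) (dec-true (s ≟ t) s≡t))

δ-≢ : ∀ {s t : Fin n} → s ≢ t → δ s t ≡ 0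
δ-≢ {s = s} {t} s≢t = cong (if_then 1 else 0) (trans (isYes≗does (s ≟ t)) (dec-false (s ≟ t) s≢t))

δ-positive : ∀ {s t : Fin n} → 0 < δ s t → s ≡ t
δ-positive {s = s} {t} 0<δ with s ≟ t
... | yes s≡t = s≡t
... | no  _   = contradiction 0<δ λ ()

δ-sym : ∀ (s t : Fin n) → δ s t ≡ δ t s
δ-sym s t = by-cases (s ≟ t)
  where
  by-cases : Dec (s ≡ t) → δ s t ≡ δ t s
  by-cases (yes s≡t) = trans (δ-≡ s≡t) (sym (δ-≡ (sym s≡t)))
  by-cases (no  s≢t) = trans (δ-≢ s≢t) (sym (δ-≢ (s≢t ∘ sym)))

-- Not definitional: ⌊ suc s ≟ suc t ⌋ is stuck on the map′ inside _≟_.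
δ-suc : ∀ (s t : Fin n) → δ (suc s) (suc t) ≡ δ s t
δ-suc s t = by-cases (s ≟ t)
  where
  by-cases : Dec (s ≡ t) → δ (suc s) (suc t) ≡ δ s t
  by-cases (yes s≡t) = trans (δ-≡ (cong suc s≡t)) (sym (δ-≡ s≡t))
  by-cases (no  s≢t) = trans (δ-≢ (s≢t ∘ suc-injective)) (sym (δ-≢ s≢t))

sum-δ : ∀ (t : Fin n) → sumFin n (δ t) ≡ 1
sum-δ {suc n} zero    = cong suc (sum-zero n)
sum-δ {suc n} (suc t) = trans (sum-cong (δ-suc t)) (sum-δ t)

sum-δʳ : ∀ (t : Fin n) → sumFin n (λ s → δ s t) ≡ 1
sum-δʳ t = trans (sum-cong (λ s → δ-sym s t)) (sum-δ t)

sucC2 : ∀ n → suc n C 2 ≡ n + n C 2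
sucC2 n = trans (sym (nCk+nC[k+1]≡[n+1]C[k+1] n 1)) (cong (_+ n C 2) (nC1≡n n))

C2-mono : m ≤ n → m C 2 ≤ n C 2
C2-mono = go ∘ ≤⇒≤′
  where
  go : m ≤′ n → m C 2 ≤ n C 2
  go ≤′-refl               = ≤-refl
  go (≤′-step {n} m≤′n) = ≤-trans (go m≤′n) (subst (n C 2 ≤_) (sym (sucC2 n)) (m≤n+m _ n))

double-C2 : ∀ n → 2 * (n C 2) ≡ n * (n ∸ 1)
double-C2 zero          = refl
double-C2 (suc zero)    = refl
double-C2 (suc (suc n)) = begin
  2 * (suc (suc n) C 2)         ≡⟨ cong (2 *_) (sucC2 (suc n)) ⟩
  2 * (suc n + suc n C 2)       ≡⟨ *-distribˡ-+ 2 (suc n) _ ⟩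
  2 * suc n + 2 * (suc n C 2)   ≡⟨ cong (2 * suc n +_) (double-C2 (suc n)) ⟩
  2 * suc n + suc n * n         ≡⟨ expand n ⟩
  suc (suc n) * suc n           ∎
  where
  open ≡-Reasoning
  expand : ∀ n → 2 * suc n + suc n * n ≡ suc (suc n) * suc n
  expand = solve-∀

-- sumPairs n F unfolds to the sum of upper F over all of Fin n × Fin n.
upper : (Fin n → Fin n → ℕ) → Fin n → Fin n → ℕ
upper F i j = if toℕ i <ᵇ toℕ j then F i j else 0

upper-< : ∀ (F : Fin n → Fin n → ℕ) {i j} → toℕ i < toℕ j → upper F i j ≡ F i j
upper-< F {i} {j} i<j with toℕ i <ᵇ toℕ j in eq
... | true  = refl
... | false = ⊥-elim (subst T eq (<⇒<ᵇ i<j))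

upper-positive : ∀ (F : Fin n → Fin n → ℕ) {i j} → 0 < upper F i j → toℕ i < toℕ j
upper-positive F {i} {j} 0<F with toℕ i <ᵇ toℕ j in eq
... | true  = <ᵇ⇒< (toℕ i) (toℕ j) (subst T (sym eq) tt)
... | false = contradiction 0<F λ ()

upper-mono : ∀ {F G : Fin n → Fin n → ℕ} → (∀ i j → toℕ i < toℕ j → F i j ≤ G i j) →
             ∀ i j → upper F i j ≤ upper G i j
upper-mono F≤G i j with toℕ i <ᵇ toℕ j in eq
... | true  = F≤G i j (<ᵇ⇒< (toℕ i) (toℕ j) (subst T (sym eq) tt))
... | false = z≤n

module _ {F G : Fin n → Fin n → ℕ} (F≤G : ∀ i j → toℕ i < toℕ j → F i j ≤ G i j) where

  sumPairs-mono : sumPairs n F ≤ sumPairs n G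
  sumPairs-mono = sum-mono (λ i → sum-mono (upper-mono F≤G i))

  sumPairs-mono-< : ∀ {i j} → toℕ i < toℕ j → F i j < G i j → sumPairs n F < sumPairs n G
  sumPairs-mono-< {i} i<j Fij<Gij = sum-mono-< (λ i → sum-mono (upper-mono F≤G i))
    (sum-mono-< (upper-mono F≤G i) (subst₂ _<_ (sym (upper-< F i<j)) (sym (upper-< G i<j)) Fij<Gij))

sumPairs-const : ∀ n b → sumPairs n (λ _ _ → b) ≡ (n C 2) * b
sumPairs-const zero    b = refl
sumPairs-const (suc n) b = begin
  sumFin n (λ _ → b) + sumPairs n (λ _ _ → b) ≡⟨ cong₂ _+_ (sum-const n b) (sumPairs-const n b) ⟩
  n * b + (n C 2) * b                        ≡⟨ *-distribʳ-+ b n (n C 2) ⟨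
  (n + n C 2) * b                            ≡⟨ cong (_* b) (sucC2 n) ⟨
  (suc n C 2) * b                            ∎
  where open ≡-Reasoning

sumPairs-swap : ∀ (F : Fin m → Fin n → Fin n → ℕ) →
                sumPairs n (λ i j → sumFin m (λ x → F x i j)) ≡ sumFin m (λ x → sumPairs n (F x))
sumPairs-swap {m} {n} F = begin
  sumFin n (λ i → sumFin n (upper (λ i j → sumFin m (λ x → F x i j)) i))
    ≡⟨ sum-cong (λ i → sum-cong (upper-sum i)) ⟩
  sumFin n (λ i → sumFin n (λ j → sumFin m (λ x → upper (F x) i j)))
    ≡⟨ sum-cong (λ i → sum-swap (λ j x → upper (F x) i j)) ⟩
  sumFin n (λ i → sumFin m (λ x → sumFin n (upper (F x) i)))
    ≡⟨ sum-swap (λ i x → sumFin n (upper (F x) i)) ⟩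
  sumFin m (λ x → sumPairs n (F x)) ∎
  where
  open ≡-Reasoning
  upper-sum : ∀ i j → upper (λ i j → sumFin m (λ x → F x i j)) i j ≡ sumFin m (λ x → upper (F x) i j)
  upper-sum i j with toℕ i <ᵇ toℕ j
  ... | true  = refl
  ... | false = sym (sum-zero m)

sumPairs-indicator : ∀ (y : Fin n → ℕ) → (∀ i → y i ≤ 1) →
                     sumPairs n (λ i j → y i * y j) ≡ sumFin n y C 2
sumPairs-indicator {zero}  y y≤1 = refl
sumPairs-indicator {suc n} y y≤1
  with y zero | y≤1 zero | sumPairs-indicator (y ∘ suc) (y≤1 ∘ suc)
... | 0 | _ | ih = trans (cong (_+ sumPairs n (λ i j → y (suc i) * y (suc j))) (sum-*ˡ 0 (y ∘ suc))) ih
... | 1 | _ | ih = begin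
  sumFin n (λ j → 1 * y (suc j)) + sumPairs n (λ i j → y (suc i) * y (suc j))
    ≡⟨ cong₂ _+_ (trans (sum-*ˡ 1 (y ∘ suc)) (*-identityˡ _)) ih ⟩
  sumFin n (y ∘ suc) + sumFin n (y ∘ suc) C 2
    ≡⟨ sucC2 (sumFin n (y ∘ suc)) ⟨
  suc (sumFin n (y ∘ suc)) C 2 ∎
  where open ≡-Reasoning
... | suc (suc _) | s≤s () | _

maximal-pair : ∀ (F : Fin n → Fin n → ℕ) {i₀ j₀} → toℕ i₀ < toℕ j₀ →
               ∃ λ ((p , q) : Fin n × Fin n) → toℕ p < toℕ q × (∀ i j → toℕ i < toℕ j → F i j ≤ F p q)
maximal-pair {n} F {i₀} {j₀} i₀<j₀ = best , best-is-pair , best-is-maximal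
  where
  -- Shifting F by one makes every genuine pair outweigh the masked ones,
  -- so the argmax of the masked weight is itself a pair i < j.
  F⁺ : Fin n → Fin n → ℕ
  F⁺ i j = suc (F i j)
  weight : Fin n × Fin n → ℕ
  weight (i , j) = upper F⁺ i j
  pairs : List (Fin n × Fin n)
  pairs = cartesianProduct (allFin n) (allFin n)
  best : Fin n × Fin n
  best = argmax weight (i₀ , j₀) pairs
  best-is-pair : toℕ (proj₁ best) < toℕ (proj₂ best)
  best-is-pair = upper-positive F⁺
    (<-≤-trans (subst (0 <_) (sym (upper-< F⁺ i₀<j₀)) z<s) (f[⊥]≤f[argmax] {f = weight} (i₀ , j₀) pairs))
  best-is-maximal : ∀ i j → toℕ i < toℕ j → F i j ≤ F (proj₁ best) (proj₂ best)
  best-is-maximal i j i<j = ≤-pred (subst₂ _≤_ (upper-< F⁺ i<j) (upper-< F⁺ best-is-pair)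
    (All.lookup (f[xs]≤f[argmax] {f = weight} (i₀ , j₀) pairs)
                (∈-cartesianProduct⁺ (∈-allFin i) (∈-allFin j))))

-- Floors and ceilings of averages

FloorOrCeil⇒0<N : ∀ {S N x} → FloorOrCeil S N x → 0 < N
FloorOrCeil⇒0<N {N = suc _} _ = z<s
FloorOrCeil⇒0<N {S} {zero} {x} (inj₁ (_ , S<x*0+0)) =
  contradiction (subst (S <_) (trans (+-identityʳ (x * 0)) (*-zeroʳ x)) S<x*0+0) n≮0
FloorOrCeil⇒0<N {S} {zero} {x} (inj₂ (S≤x*0 , x*0<S+0)) =
  contradiction (≤-trans (subst₂ _<_ (*-zeroʳ x) (+-identityʳ S) x*0<S+0) (subst (S ≤_) (*-zeroʳ x) S≤x*0)) n≮0

[1+a]*N≡a*N+N : ∀ a N → suc a * N ≡ a * N + N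
[1+a]*N≡a*N+N a N = +-comm N (a * N)

FloorOrCeil-≤ : ∀ {S N x b} → FloorOrCeil S N x → S ≤ b * N → x ≤ b
FloorOrCeil-≤ {S} {N} {x} {b} fc@(inj₁ (xN≤S , _)) S≤bN =
  *-cancelʳ-≤ x b N {{>-nonZero (FloorOrCeil⇒0<N {x = x} fc)}} (≤-trans xN≤S S≤bN)
FloorOrCeil-≤ {S} {N} {x} {b} (inj₂ (_ , xN<S+N)) S≤bN =
  ≤-pred (*-cancelʳ-< N x (suc b) (<-≤-trans xN<S+N
    (subst (S + N ≤_) (sym ([1+a]*N≡a*N+N b N)) (+-monoˡ-≤ N S≤bN))))

FloorOrCeil-≥ : ∀ {S N x b} → FloorOrCeil S N x → b * N ≤ S → b ≤ x
FloorOrCeil-≥ {S} {N} {x} {b} (inj₁ (_ , S<xN+N)) bN≤S =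
  ≤-pred (*-cancelʳ-< N b (suc x) (≤-<-trans bN≤S (subst (S <_) (sym ([1+a]*N≡a*N+N x N)) S<xN+N)))
FloorOrCeil-≥ {S} {N} {x} {b} fc@(inj₂ (S≤xN , _)) bN≤S =
  *-cancelʳ-≤ b x N {{>-nonZero (FloorOrCeil⇒0<N {x = x} fc)}} (≤-trans bN≤S S≤xN)

FloorOrCeil-close : ∀ {S N x y} → FloorOrCeil S N x → FloorOrCeil S N y → x ≤ suc y
FloorOrCeil-close {S} {N} {y = y} fx fy = FloorOrCeil-≤ fx (S≤[1+y]N fy)
  where
  S≤[1+y]N : FloorOrCeil S N y → S ≤ suc y * N
  S≤[1+y]N (inj₁ (_ , S<yN+N)) = <⇒≤ (subst (S <_) (sym ([1+a]*N≡a*N+N y N)) S<yN+N)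
  S≤[1+y]N (inj₂ (S≤yN , _))   = ≤-trans S≤yN (m≤n+m (y * N) N)

module Average {I : Set} (D : I → Set) (∑ : (I → ℕ) → ℕ) (N : ℕ)
  (∑-const : ∀ b → ∑ (λ _ → b) ≡ N * b)
  (∑-mono : ∀ {f g : I → ℕ} → (∀ i → D i → f i ≤ g i) → ∑ f ≤ ∑ g)
  (∑-mono-< : ∀ {f g : I → ℕ} {i} → (∀ i → D i → f i ≤ g i) → D i → f i < g i → ∑ f < ∑ g)
  where

  FloorOrCeil-average : ∀ {f : I → ℕ} a → (∀ i → D i → a ≤ f i × f i ≤ suc a) →
                        ∀ {i} → D i → FloorOrCeil (∑ f) N (f i)
  FloorOrCeil-average {f} a near {i} Di with m≤n⇒m<n∨m≡n (proj₁ (near i Di))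
  ... | inj₂ refl = inj₁ (f[i]N≤∑f , ∑f<f[i]N+N)
    where
    f[i]N≤∑f : f i * N ≤ ∑ f
    f[i]N≤∑f = subst (_≤ ∑ f) (trans (∑-const (f i)) (*-comm N (f i))) (∑-mono (λ j Dj → proj₁ (near j Dj)))
    ∑f<f[i]N+N : ∑ f < f i * N + N
    ∑f<f[i]N+N = subst (∑ f <_) (trans (∑-const (suc (f i))) (trans (*-comm N _) ([1+a]*N≡a*N+N (f i) N)))
                   (∑-mono-< (λ j Dj → proj₂ (near j Dj)) Di ≤-refl)
  ... | inj₁ a<f[i] =
    inj₂ (subst (IsCeil (∑ f) N) (≤-antisym a<f[i] (proj₂ (near i Di))) (∑f≤f[i]N , f[i]N<∑f+N))
    where
    ∑f≤f[i]N : ∑ f ≤ suc a * N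
    ∑f≤f[i]N = subst (∑ f ≤_) (trans (∑-const (suc a)) (*-comm N _)) (∑-mono (λ j Dj → proj₂ (near j Dj)))
    f[i]N<∑f+N : suc a * N < ∑ f + N
    f[i]N<∑f+N = subst (_< ∑ f + N) (sym ([1+a]*N≡a*N+N a N))
                   (+-monoˡ-< N (subst (_< ∑ f) (trans (∑-const a) (*-comm N a))
                     (∑-mono-< (λ j Dj → proj₁ (near j Dj)) Di a<f[i])))

FloorOrCeil-sumFin : ∀ (f : Fin n → ℕ) a → (∀ i → a ≤ f i × f i ≤ suc a) →
                     ∀ i → FloorOrCeil (sumFin n f) n (f i)
FloorOrCeil-sumFin {n} f a near i =
  Average.FloorOrCeil-average (λ _ → ⊤) (sumFin n) n (sum-const n)
    (λ f≤g → sum-mono (λ i → f≤g i tt)) (λ f≤g _ → sum-mono-< (λ i → f≤g i tt))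
    a (λ i _ → near i) tt

FloorOrCeil-sumGrid : ∀ {r c} (F : Fin r → Fin c → ℕ) a → (∀ i j → a ≤ F i j × F i j ≤ suc a) →
                      ∀ i j → FloorOrCeil (sumFin r (λ i → sumFin c (F i))) (r * c) (F i j)
FloorOrCeil-sumGrid {r} {c} F a near i j =
  Average.FloorOrCeil-average (λ _ → ⊤) (λ f → sumFin r (λ i → sumFin c (λ j → f (i , j)))) (r * c)
    grid-const
    (λ f≤g → sum-mono (λ i → sum-mono (λ j → f≤g (i , j) tt)))
    (λ { {i = i , j} f≤g _ fij<gij →
         sum-mono-< (λ i → sum-mono (λ j → f≤g (i , j) tt)) (sum-mono-< (λ j → f≤g (i , j) tt) fij<gij) })
    a (λ (i , j) _ → near i j) {i , j} tt
  where
  grid-const : ∀ b → sumFin r (λ _ → sumFin c (λ _ → b)) ≡ r * c * b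
  grid-const b = trans (sum-cong {r} (λ _ → sum-const c b)) (trans (sum-const r (c * b)) (sym (*-assoc r c b)))

FloorOrCeil-sumPairs : ∀ (F : Fin n → Fin n → ℕ) a →
                       (∀ i j → toℕ i < toℕ j → a ≤ F i j × F i j ≤ suc a) →
                       ∀ i j → toℕ i < toℕ j → FloorOrCeil (sumPairs n F) (n C 2) (F i j)
FloorOrCeil-sumPairs {n} F a near i j i<j =
  Average.FloorOrCeil-average (λ (i , j) → toℕ i < toℕ j) (λ f → sumPairs n (λ i j → f (i , j))) (n C 2)
    (sumPairs-const n)
    (λ f≤g → sumPairs-mono (λ i j → f≤g (i , j)))
    (λ f≤g i<j → sumPairs-mono-< (λ i j → f≤g (i , j)) i<j)
    a (λ (i , j) → near i j) {i , j} i<j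

χ : Subset n → Fin n → ℕ
χ p x = if lookup p x then 1 else 0

∣p∣≡sum-χ : ∀ (p : Subset n) → ∣ p ∣ ≡ sumFin n (χ p)
∣p∣≡sum-χ []            = refl
∣p∣≡sum-χ (inside  ∷ p) = cong suc (∣p∣≡sum-χ p)
∣p∣≡sum-χ (outside ∷ p) = ∣p∣≡sum-χ p

χ-∩ : ∀ (p q : Subset n) x → χ (p ∩ q) x ≡ χ p x * χ q x
χ-∩ (inside  ∷ p) (s ∷ q) zero    = sym (*-identityˡ _)
χ-∩ (outside ∷ p) (s ∷ q) zero    = refl
χ-∩ (_       ∷ p) (_ ∷ q) (suc x) = χ-∩ p q x

∣p∩q∣≡sum-χχ : ∀ (p q : Subset n) → ∣ p ∩ q ∣ ≡ sumFin n (λ x → χ p x * χ q x)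
∣p∩q∣≡sum-χχ p q = trans (∣p∣≡sum-χ (p ∩ q)) (sum-cong (χ-∩ p q))

χ-≤1 : ∀ (p : Subset n) x → χ p x ≤ 1
χ-≤1 p x with lookup p x
... | true  = ≤-refl
... | false = z≤n

χ-∈ : x ∈ p → χ p x ≡ 1
χ-∈ x∈p rewrite []=⇒lookup x∈p = refl

x∈p⇒0<∣p∣ : x ∈ p → 0 < ∣ p ∣
x∈p⇒0<∣p∣ {x = x} {p} x∈p =
  subst (0 <_) (sym (∣p∣≡sum-χ p)) (≤-trans (≤-reflexive (sym (χ-∈ x∈p))) (term≤sum (χ p) x))

0<∣p∣⇒Nonempty : 0 < ∣ p ∣ → Nonempty p
0<∣p∣⇒Nonempty {n} {p} 0<∣p∣ with nonempty? p
... | yes ne = ne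
... | no ¬ne = contradiction (subst (0 <_) (trans (cong ∣_∣ (Empty-unique ¬ne)) (∣⊥∣≡0 n)) 0<∣p∣) λ ()

x∈p─q⇒x∉q : x ∈ p ─ q → x ∉ q
x∈p─q⇒x∉q {p = _ ∷ _} {outside ∷ _} here          ()
x∈p─q⇒x∉q {p = _ ∷ _} {_       ∷ _} (there x∈p─q) (there x∈q) = x∈p─q⇒x∉q x∈p─q x∈q

x∈p-y⇒x≢y : x ∈ p - y → x ≢ y
x∈p-y⇒x≢y x∈p-x refl = x∈p─q⇒x∉q x∈p-x (x∈⁅x⁆ _)

x∉p⇒p-x≡p : x ∉ p → p - x ≡ p
x∉p⇒p-x≡p {p = p} x∉p =
  ⊆-antisym (p─q⊆p p _) (λ y∈p → x∈p∧x≢y⇒x∈p-y y∈p λ { refl → x∉p y∈p })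

p∩[q-x]≡p∩q-x : ∀ (p q : Subset n) x → p ∩ (q - x) ≡ p ∩ q - x
p∩[q-x]≡p∩q-x p q x = ⊆-antisym lhs⊆rhs rhs⊆lhs
  where
  lhs⊆rhs : p ∩ (q - x) ⊆ p ∩ q - x
  lhs⊆rhs y∈ = let (y∈p , y∈q-x) = x∈p∩q⁻ p _ y∈ in
    x∈p∧x≢y⇒x∈p-y (x∈p∩q⁺ (y∈p , p─q⊆p q _ y∈q-x)) (x∈p-y⇒x≢y y∈q-x)
  rhs⊆lhs : p ∩ q - x ⊆ p ∩ (q - x)
  rhs⊆lhs y∈ = let (y∈p , y∈q) = x∈p∩q⁻ p q (p─q⊆p _ _ y∈) in
    x∈p∩q⁺ (y∈p , x∈p∧x≢y⇒x∈p-y y∈q (x∈p-y⇒x≢y y∈))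

[p-x]∩q≡p∩q-x : ∀ (p q : Subset n) x → (p - x) ∩ q ≡ p ∩ q - x
[p-x]∩q≡p∩q-x p q x = begin
  (p - x) ∩ q  ≡⟨ ∩-comm (p - x) q ⟩
  q ∩ (p - x)  ≡⟨ p∩[q-x]≡p∩q-x q p x ⟩
  q ∩ p - x    ≡⟨ cong (_- x) (∩-comm q p) ⟩
  p ∩ q - x    ∎
  where open ≡-Reasoning

∣p∩[q-x]∣≤∣p∩q∣ : ∀ (p q : Subset n) x → ∣ p ∩ (q - x) ∣ ≤ ∣ p ∩ q ∣
∣p∩[q-x]∣≤∣p∩q∣ p q x =
  subst (_≤ ∣ p ∩ q ∣) (cong ∣_∣ (sym (p∩[q-x]≡p∩q-x p q x))) (∣p─q∣≤∣p∣ (p ∩ q) _)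

∣[p-x]∩q∣≤∣p∩q∣ : ∀ (p q : Subset n) x → ∣ (p - x) ∩ q ∣ ≤ ∣ p ∩ q ∣
∣[p-x]∩q∣≤∣p∩q∣ p q x =
  subst (_≤ ∣ p ∩ q ∣) (cong ∣_∣ (sym ([p-x]∩q≡p∩q-x p q x))) (∣p─q∣≤∣p∣ (p ∩ q) _)

∣p∣≤1+∣p-x∣ : ∀ (p : Subset n) x → ∣ p ∣ ≤ suc ∣ p - x ∣
∣p∣≤1+∣p-x∣ (inside  ∷ p) zero    = ≤-reflexive (cong (suc ∘ ∣_∣) (sym (p─⊥≡p p)))
∣p∣≤1+∣p-x∣ (outside ∷ p) zero    = ≤-trans (≤-reflexive (cong ∣_∣ (sym (p─⊥≡p p)))) (n≤1+n _)
∣p∣≤1+∣p-x∣ (inside  ∷ p) (suc x) = s≤s (∣p∣≤1+∣p-x∣ p x)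
∣p∣≤1+∣p-x∣ (outside ∷ p) (suc x) = ∣p∣≤1+∣p-x∣ p x

x∈p⇒1+∣p-x∣≡∣p∣ : x ∈ p → suc ∣ p - x ∣ ≡ ∣ p ∣
x∈p⇒1+∣p-x∣≡∣p∣ {x = x} {p} x∈p = ≤-antisym (x∈p⇒∣p-x∣<∣p∣ x∈p) (∣p∣≤1+∣p-x∣ p x)

-- rowSet A i and colSet A j unfold to image (A i) and image (λ i → A i j).
image : (Fin m → Fin n) → Subset n
image {m} g = ⋃ (map (λ j → ⁅ g j ⁆) (allFin m))

∈-⋃⁺ : ∀ {ps : List (Subset n)} → Any (x ∈_) ps → x ∈ ⋃ ps
∈-⋃⁺ (Any.here x∈p)   = x∈p∪q⁺ (inj₁ x∈p)
∈-⋃⁺ (Any.there x∈ps) = x∈p∪q⁺ (inj₂ (∈-⋃⁺ x∈ps))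

∈-⋃⁻ : ∀ (ps : List (Subset n)) → x ∈ ⋃ ps → Any (x ∈_) ps
∈-⋃⁻ []ᴸ        x∈⊥ = contradiction x∈⊥ ∉⊥
∈-⋃⁻ (p ∷ᴸ ps) x∈  with x∈p∪q⁻ p (⋃ ps) x∈
... | inj₁ x∈p   = Any.here x∈p
... | inj₂ x∈⋃ps = Any.there (∈-⋃⁻ ps x∈⋃ps)

∈-image⁺ : ∀ (g : Fin m → Fin n) j → g j ∈ image g
∈-image⁺ g j = ∈-⋃⁺ (map⁺ (Any.map (λ { refl → x∈⁅x⁆ (g j) }) (∈-allFin j)))

∈-image⁻ : ∀ (g : Fin m → Fin n) → x ∈ image g → ∃ λ j → g j ≡ x
∈-image⁻ {m} g x∈ =
  let (j , x∈⁅gj⁆) = satisfied (map⁻ (∈-⋃⁻ (map (λ j → ⁅ g j ⁆) (allFin m)) x∈)) in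
  j , sym (x∈⁅y⁆⇒x≡y (g j) x∈⁅gj⁆)

image-cong : ∀ {g h : Fin m → Fin n} → (∀ j → g j ≡ h j) → image g ≡ image h
image-cong {m} g≗h = cong ⋃ (map-cong (cong ⁅_⁆ ∘ g≗h) (allFin m))

image-suc : ∀ (g : Fin m → Fin n) → image (suc ∘ g) ≡ outside ∷ image g
image-suc {m} g = go (allFin m)
  where
  go : ∀ js → ⋃ (map (λ j → ⁅ suc (g j) ⁆) js) ≡ outside ∷ ⋃ (map (λ j → ⁅ g j ⁆) js)
  go []ᴸ       = refl
  go (j ∷ᴸ js) = cong (⁅ suc (g j) ⁆ ∪_) (go js)

χ-image≤count : ∀ (g : Fin m → Fin n) x → χ (image g) x ≤ sumFin m (λ j → δ (g j) x)
χ-image≤count g x with lookup (image g) x in eq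
... | false = z≤n
... | true  = let (j , gj≡x) = ∈-image⁻ g (lookup⇒[]= x (image g) eq) in
  ≤-trans (≤-reflexive (sym (δ-≡ gj≡x))) (term≤sum (λ j → δ (g j) x) j)

freshAt : Fin m → (Fin m → Fin n) → Fin m → Fin (suc n)
freshAt k g j = if ⌊ j ≟ k ⌋ then zero else suc (g j)

module _ {k : Fin m} {g : Fin m → Fin n} where

  freshAt-self : freshAt k g k ≡ zero
  freshAt-self with k ≟ k
  ... | yes _   = refl
  ... | no  k≢k = contradiction refl k≢k

  freshAt-≢ : ∀ {j} → j ≢ k → freshAt k g j ≡ suc (g j)
  freshAt-≢ {j} j≢k with j ≟ k
  ... | yes j≡k = contradiction j≡k j≢k
  ... | no  _   = refl

  freshAt-view : ∀ j → (j ≡ k × freshAt k g j ≡ zero) ⊎ (j ≢ k × freshAt k g j ≡ suc (g j))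
  freshAt-view j with j ≟ k
  ... | yes j≡k = inj₁ (j≡k , refl)
  ... | no  j≢k = inj₂ (j≢k , refl)

  freshAt-injective : Injective _≡_ _≡_ g → Injective _≡_ _≡_ (freshAt k g)
  freshAt-injective g-inj {j} {j′} eq with freshAt-view j | freshAt-view j′
  ... | inj₁ (j≡k , _)  | inj₁ (j′≡k , _)  = trans j≡k (sym j′≡k)
  ... | inj₁ (_ , e)    | inj₂ (_ , e′)    = contradiction (trans (sym e) (trans eq e′)) λ ()
  ... | inj₂ (_ , e)    | inj₁ (_ , e′)    = contradiction (trans (sym e) (trans eq e′)) λ ()
  ... | inj₂ (_ , e)    | inj₂ (_ , e′)    = g-inj (suc-injective (trans (sym e) (trans eq e′)))

  image-freshAt : Injective _≡_ _≡_ g → image (freshAt k g) ≡ inside ∷ (image g - g k)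
  image-freshAt g-inj = ⊆-antisym lhs⊆rhs rhs⊆lhs
    where
    lhs⊆rhs : image (freshAt k g) ⊆ inside ∷ (image g - g k)
    lhs⊆rhs y∈ with ∈-image⁻ (freshAt k g) y∈
    ... | j , refl with freshAt-view j
    ...   | inj₁ (_ , e)   rewrite e = here
    ...   | inj₂ (j≢k , e) rewrite e = there (x∈p∧x≢y⇒x∈p-y (∈-image⁺ g j) (j≢k ∘ g-inj))
    rhs⊆lhs : inside ∷ (image g - g k) ⊆ image (freshAt k g)
    rhs⊆lhs here = subst (_∈ image (freshAt k g)) freshAt-self (∈-image⁺ (freshAt k g) k)
    rhs⊆lhs (there y∈) with ∈-image⁻ g (p─q⊆p _ _ y∈)
    ... | j , refl =
      subst (_∈ image (freshAt k g)) (freshAt-≢ (x∈p-y⇒x≢y y∈ ∘ cong g)) (∈-image⁺ (freshAt k g) j)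

-- Double counting in designs

module _ {r c v : ℕ} (A : Design r c v) where

  rowCount : Fin r → Fin v → ℕ
  rowCount i x = sumFin c (λ j → δ (A i j) x)

  colCount : Fin c → Fin v → ℕ
  colCount j x = sumFin r (λ i → δ (A i j) x)

  sum-colCount : ∀ x → sumFin c (λ j → colCount j x) ≡ occ A x
  sum-colCount x = sym (sum-swap (λ i j → δ (A i j) x))

  ∈-rowSet⇒0<rowCount : ∀ {i x} → x ∈ rowSet A i → 0 < rowCount i x
  ∈-rowSet⇒0<rowCount {i} {x} x∈Ri =
    let (j , Aij≡x) = ∈-image⁻ (A i) x∈Ri in
    ≤-trans (≤-reflexive (sym (δ-≡ Aij≡x))) (term≤sum (λ j → δ (A i j) x) j)

  δ≤occ : ∀ i j x → δ (A i j) x ≤ occ A x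
  δ≤occ i j x = ≤-trans (term≤sum _ j) (term≤sum (λ i → rowCount i x) i)

  occ-positive⇒cell : ∀ {x} → 0 < occ A x → ∃₂ λ i j → A i j ≡ x
  occ-positive⇒cell 0<occ =
    let (i , 0<rowCount) = sum-positive 0<occ
        (j , 0<δ)        = sum-positive 0<rowCount
    in i , j , δ-positive 0<δ

  sum-occ : sumFin v (occ A) ≡ r * c
  sum-occ = begin
    sumFin v (λ x → sumFin r (λ i → rowCount i x))
      ≡⟨ sum-swap (λ i x → rowCount i x) ⟨
    sumFin r (λ i → sumFin v (rowCount i))
      ≡⟨ sum-cong (λ i → sum-swap (λ j x → δ (A i j) x)) ⟨
    sumFin r (λ i → sumFin c (λ j → sumFin v (δ (A i j))))
      ≡⟨ sum-cong (λ i → sum-cong (λ j → sum-δ (A i j))) ⟩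
    sumFin r (λ i → sumFin c (λ j → 1))
      ≡⟨ sum-cong {r} (λ _ → trans (sum-const c 1) (*-identityʳ c)) ⟩
    sumFin r (λ i → c)
      ≡⟨ sum-const r c ⟩
    r * c ∎
    where open ≡-Reasoning

  0<∣row∩col∣ : ∀ i j → 0 < ∣ rowSet A i ∩ colSet A j ∣
  0<∣row∩col∣ i j = x∈p⇒0<∣p∣ (x∈p∩q⁺ (∈-image⁺ (A i) j , ∈-image⁺ (λ i → A i j) i))

  Src≤sum-occ² : Src A ≤ sumFin v (λ x → occ A x * occ A x)
  Src≤sum-occ² = begin
    sumFin r (λ i → sumFin c (λ j → ∣ rowSet A i ∩ colSet A j ∣))
      ≡⟨ sum-cong (λ i → sum-cong (λ j → ∣p∩q∣≡sum-χχ (rowSet A i) (colSet A j))) ⟩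
    sumFin r (λ i → sumFin c (λ j → sumFin v (λ x → χ (rowSet A i) x * χ (colSet A j) x)))
      ≤⟨ sum-mono (λ i → sum-mono (λ j → sum-mono (λ x →
           *-mono-≤ (χ-image≤count (A i) x) (χ-image≤count (λ i → A i j) x)))) ⟩
    sumFin r (λ i → sumFin c (λ j → sumFin v (λ x → rowCount i x * colCount j x)))
      ≡⟨ sum-cong (λ i → sum-swap (λ j x → rowCount i x * colCount j x)) ⟩
    sumFin r (λ i → sumFin v (λ x → sumFin c (λ j → rowCount i x * colCount j x)))
      ≡⟨ sum-swap (λ i x → sumFin c (λ j → rowCount i x * colCount j x)) ⟩
    sumFin v (λ x → sumFin r (λ i → sumFin c (λ j → rowCount i x * colCount j x)))
      ≡⟨ sum-cong (λ x → sum-*-sum (λ i → rowCount i x) (λ j → colCount j x)) ⟩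
    sumFin v (λ x → occ A x * sumFin c (λ j → colCount j x))
      ≡⟨ sum-cong (λ x → cong (occ A x *_) (sum-colCount x)) ⟩
    sumFin v (λ x → occ A x * occ A x) ∎
    where open ≤-Reasoning

  Scc≤sum-occC2 : Scc A ≤ sumFin v (λ x → occ A x C 2)
  Scc≤sum-occC2 = begin
    sumPairs c (λ j j′ → ∣ colSet A j ∩ colSet A j′ ∣)
      ≤⟨ sumPairs-mono (λ j j′ _ → ≤-reflexive (∣p∩q∣≡sum-χχ (colSet A j) (colSet A j′))) ⟩
    sumPairs c (λ j j′ → sumFin v (λ x → χ (colSet A j) x * χ (colSet A j′) x))
      ≡⟨ sumPairs-swap (λ x j j′ → χ (colSet A j) x * χ (colSet A j′) x) ⟩
    sumFin v (λ x → sumPairs c (λ j j′ → χ (colSet A j) x * χ (colSet A j′) x))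
      ≡⟨ sum-cong (λ x → sumPairs-indicator (λ j → χ (colSet A j) x) (λ j → χ-≤1 (colSet A j) x)) ⟩
    sumFin v (λ x → sumFin c (λ j → χ (colSet A j) x) C 2)
      ≤⟨ sum-mono (λ x → C2-mono (≤-trans (sum-mono (λ j → χ-image≤count (λ i → A i j) x))
                                           (≤-reflexive (sum-colCount x)))) ⟩
    sumFin v (λ x → occ A x C 2) ∎
    where open ≤-Reasoning

rows-sharing : ∀ {r c v} (A : Design r c v) → Binary A → v < r * c →
               ∃ λ ((i , i′) : Fin r × Fin r) → toℕ i < toℕ i′ × 0 < ∣ rowSet A i ∩ rowSet A i′ ∣
rows-sharing {r} {c} A (rows-inj , _) v<rc
  with t , t′ , t<t′ , same-symbol ← pigeonhole v<rc (λ t → uncurry A (remQuot c t))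
  with remQuot {r} c t in cell | remQuot {r} c t′ in cell′
... | i , j | i′ , j′ = oriented (<-cmp (toℕ i) (toℕ i′))
  where
  Aij≡Ai′j′ : A i j ≡ A i′ j′
  Aij≡Ai′j′ = trans (cong (uncurry A) (sym cell)) (trans same-symbol (cong (uncurry A) cell′))
  shared : 0 < ∣ rowSet A i ∩ rowSet A i′ ∣
  shared = x∈p⇒0<∣p∣ (x∈p∩q⁺ (∈-image⁺ (A i) j ,
                                subst (_∈ rowSet A i′) (sym Aij≡Ai′j′) (∈-image⁺ (A i′) j′)))
  distinct-rows : toℕ i ≢ toℕ i′
  distinct-rows i≡i′ = <⇒≢ t<t′ (begin
    t                                ≡⟨ combine-remQuot {r} c t ⟨
    uncurry combine (remQuot {r} c t)  ≡⟨ cong (uncurry combine) cell ⟩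
    combine i j                      ≡⟨ cong₂ combine (toℕ-injective i≡i′) j≡j′ ⟩
    combine i′ j′                    ≡⟨ cong (uncurry combine) cell′ ⟨
    uncurry combine (remQuot {r} c t′) ≡⟨ combine-remQuot {r} c t′ ⟩
    t′                               ∎)
    where
    open ≡-Reasoning
    j≡j′ : j ≡ j′
    j≡j′ = rows-inj i′ j j′ (subst (λ i → A i j ≡ A i′ j′) (toℕ-injective i≡i′) Aij≡Ai′j′)
  oriented : Tri (toℕ i < toℕ i′) (toℕ i ≡ toℕ i′) (toℕ i′ < toℕ i) →
             ∃ λ ((i , i′) : Fin r × Fin r) → toℕ i < toℕ i′ × 0 < ∣ rowSet A i ∩ rowSet A i′ ∣
  oriented (tri< i<i′ _ _) = (i , i′) , i<i′ , shared
  oriented (tri≈ _ i≡i′ _) = contradiction i≡i′ distinct-rows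
  oriented (tri> _ _ i′<i) = (i′ , i) , i′<i , subst (λ X → 0 < ∣ X ∣) (∩-comm (rowSet A i) _) shared

-- Replacing one entry by a new symbol

freshen : ∀ {r c v} → Design r c v → Fin r → Fin c → Design r c (suc v)
freshen A q k i j = if ⌊ i ≟ q ⌋ then freshAt k (A i) j else suc (A i j)

module Freshen {r c v : ℕ} (A : Design r c v) (q : Fin r) (k : Fin c) where

  private
    B : Design r c (suc v)
    B = freshen A q k

  freshen-row : ∀ j → B q j ≡ freshAt k (A q) j
  freshen-row j with q ≟ q
  ... | yes _   = refl
  ... | no  q≢q = contradiction refl q≢q

  freshen-row-≢ : ∀ {i} → i ≢ q → ∀ j → B i j ≡ suc (A i j)
  freshen-row-≢ {i} i≢q j with i ≟ q
  ... | yes i≡q = contradiction i≡q i≢q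
  ... | no  _   = refl

  freshen-col : ∀ i → B i k ≡ freshAt q (λ i → A i k) i
  freshen-col i with i ≟ q
  ... | yes refl = freshAt-self {g = A q}
  ... | no  _    = refl

  freshen-col-≢ : ∀ {j} → j ≢ k → ∀ i → B i j ≡ suc (A i j)
  freshen-col-≢ j≢k i with i ≟ q
  ... | yes refl = freshAt-≢ {g = A q} j≢k
  ... | no  _    = refl

  freshen-binary : Binary A → Binary B
  freshen-binary (rows-inj , cols-inj) = rows-inj′ , cols-inj′
    where
    rows-inj′ : ∀ i j j′ → B i j ≡ B i j′ → j ≡ j′
    rows-inj′ i j j′ with i ≟ q
    ... | yes refl = freshAt-injective (rows-inj q _ _)
    ... | no  _    = rows-inj i j j′ ∘ suc-injective
    cols-inj′ : ∀ j i i′ → B i j ≡ B i′ j → i ≡ i′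
    cols-inj′ j i i′ eq = by-cases (j ≟ k)
      where
      by-cases : Dec (j ≡ k) → i ≡ i′
      by-cases (yes j≡k) = freshAt-injective (cols-inj k _ _)
        (trans (sym (freshen-col i)) (trans (subst (λ j → B i j ≡ B i′ j) j≡k eq) (freshen-col i′)))
      by-cases (no  j≢k) = cols-inj j i i′ (suc-injective
        (trans (sym (freshen-col-≢ j≢k i)) (trans eq (freshen-col-≢ j≢k i′))))

  module _ (bin : Binary A) where

    rowSet-freshen : rowSet B q ≡ inside ∷ (rowSet A q - A q k)
    rowSet-freshen = trans (image-cong freshen-row) (image-freshAt (proj₁ bin q _ _))

    colSet-freshen : colSet B k ≡ inside ∷ (colSet A k - A q k)
    colSet-freshen = trans (image-cong freshen-col) (image-freshAt (proj₂ bin k _ _))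

  rowSet-freshen-≢ : ∀ {i} → i ≢ q → rowSet B i ≡ outside ∷ rowSet A i
  rowSet-freshen-≢ {i} i≢q = trans (image-cong (freshen-row-≢ i≢q)) (image-suc (A i))

  colSet-freshen-≢ : ∀ {j} → j ≢ k → colSet B j ≡ outside ∷ colSet A j
  colSet-freshen-≢ {j} j≢k = trans (image-cong (freshen-col-≢ j≢k)) (image-suc (λ i → A i j))

  occ-freshen-zero : occ B zero ≡ 1
  occ-freshen-zero = begin
    sumFin r (λ i → sumFin c (λ j → δ (B i j) zero)) ≡⟨ sum-cong (λ i → sum-cong (δ-fresh i)) ⟩
    sumFin r (λ i → sumFin c (λ j → δ i q * δ j k))  ≡⟨ sum-*-sum (λ i → δ i q) (λ j → δ j k) ⟩
    sumFin r (λ i → δ i q) * sumFin c (λ j → δ j k)  ≡⟨ cong₂ _*_ (sum-δʳ q) (sum-δʳ k) ⟩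
    1                                               ∎
    where
    open ≡-Reasoning
    δ-fresh : ∀ i j → δ (B i j) zero ≡ δ i q * δ j k
    δ-fresh i j with i ≟ q | j ≟ k
    ... | yes _ | yes _ = refl
    ... | yes _ | no  _ = refl
    ... | no  _ | _     = refl

  occ-freshen-suc : ∀ x → occ B (suc x) ≤ occ A x
  occ-freshen-suc x = sum-mono (λ i → sum-mono (λ j → δ-shift i j))
    where
    δ-shift : ∀ i j → δ (B i j) (suc x) ≤ δ (A i j) x
    δ-shift i j with i ≟ q | j ≟ k
    ... | yes _ | yes _ = z≤n
    ... | yes _ | no  _ = ≤-reflexive (δ-suc (A i j) x)
    ... | no  _ | _     = ≤-reflexive (δ-suc (A i j) x)

  occ-freshen-positive : ∀ {i j x} → A i j ≡ x → i ≢ q ⊎ j ≢ k → 0 < occ B (suc x)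
  occ-freshen-positive {i} {j} {x} Aij≡x i≢q⊎j≢k =
    ≤-trans (≤-reflexive (sym (δ-≡ Bij≡suc-x))) (δ≤occ B i j (suc x))
    where
    Bij≡suc-x : B i j ≡ suc x
    Bij≡suc-x = trans ([ (λ i≢q → freshen-row-≢ i≢q j) , (λ j≢k → freshen-col-≢ j≢k i) ] i≢q⊎j≢k)
                      (cong suc Aij≡x)

square-on-[1,2] : ∀ {k} → 1 ≤ k → k ≤ 2 → k * k + 2 ≡ 3 * k
square-on-[1,2] {1}                 _ _                 = refl
square-on-[1,2] {2}                 _ _                 = refl
square-on-[1,2] {suc (suc (suc _))} _ (s≤s (s≤s ()))

C2-on-[1,2] : ∀ {k} → 1 ≤ k → k ≤ 2 → k C 2 + 1 ≡ k
C2-on-[1,2] {1}                 _ _                 = refl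
C2-on-[1,2] {2}                 _ _                 = refl
C2-on-[1,2] {suc (suc (suc _))} _ (s≤s (s≤s ()))

module Step {r c v : ℕ} (A : Design r c v) (bin : Binary A)
  (occ≈ : ∀ x → FloorOrCeil (r * c) v (occ A x))
  (rc≈ : ∀ i j → FloorOrCeil (Src A) (r * c) ∣ rowSet A i ∩ colSet A j ∣)
  (rr≈ : ∀ i i′ → toℕ i < toℕ i′ → FloorOrCeil (Srr A) (r C 2) ∣ rowSet A i ∩ rowSet A i′ ∣)
  (cc≈ : ∀ j j′ → toℕ j < toℕ j′ → FloorOrCeil (Scc A) (c C 2) ∣ colSet A j ∩ colSet A j′ ∣)
  (v<rc : v < r * c) (rc≤2v : r * c ≤ 2 * v) (rc≤v+c₂ : r * c ≤ v + c C 2)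
  where

  private
    Row : Fin r → Subset v
    Row = rowSet A
    Col : Fin c → Subset v
    Col = colSet A

  occ∈[1,2] : ∀ x → 1 ≤ occ A x × occ A x ≤ 2
  occ∈[1,2] x = FloorOrCeil-≥ (occ≈ x) (subst (_≤ r * c) (sym (*-identityˡ v)) (<⇒≤ v<rc)) ,
                FloorOrCeil-≤ (occ≈ x) rc≤2v

  row∩col≤2 : ∀ i j → ∣ Row i ∩ Col j ∣ ≤ 2
  row∩col≤2 i j = FloorOrCeil-≤ (rc≈ i j) (≤-trans (Src≤sum-occ² A) sum-occ²≤2rc)
    where
    open ≤-Reasoning
    3x≡2x+x : ∀ x → 3 * x ≡ 2 * x + x
    3x≡2x+x = solve-∀
    sum-occ²≤2rc : sumFin v (λ x → occ A x * occ A x) ≤ 2 * (r * c)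
    sum-occ²≤2rc = +-cancelʳ-≤ (v * 2) _ _ (begin
      sumFin v (λ x → occ A x * occ A x) + v * 2 ≡⟨ sum-+-const (λ x → occ A x * occ A x) 2 ⟨
      sumFin v (λ x → occ A x * occ A x + 2)     ≡⟨ sum-cong (λ x → uncurry square-on-[1,2] (occ∈[1,2] x)) ⟩
      sumFin v (λ x → 3 * occ A x)               ≡⟨ sum-*ˡ 3 (occ A) ⟩
      3 * sumFin v (occ A)                       ≡⟨ cong (3 *_) (sum-occ A) ⟩
      3 * (r * c)                                ≡⟨ 3x≡2x+x (r * c) ⟩
      2 * (r * c) + r * c                        ≤⟨ +-monoʳ-≤ (2 * (r * c)) rc≤2v ⟩
      2 * (r * c) + 2 * v                        ≡⟨ cong (2 * (r * c) +_) (*-comm 2 v) ⟩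
      2 * (r * c) + v * 2                        ∎)

  col∩col≤1 : ∀ j j′ → toℕ j < toℕ j′ → ∣ Col j ∩ Col j′ ∣ ≤ 1
  col∩col≤1 j j′ j<j′ = FloorOrCeil-≤ (cc≈ j j′ j<j′) (≤-trans (Scc≤sum-occC2 A) sum-occC2≤c₂)
    where
    open ≤-Reasoning
    sum-occC2≤c₂ : sumFin v (λ x → occ A x C 2) ≤ 1 * (c C 2)
    sum-occC2≤c₂ = +-cancelʳ-≤ (v * 1) _ _ (begin
      sumFin v (λ x → occ A x C 2) + v * 1 ≡⟨ sum-+-const (λ x → occ A x C 2) 1 ⟨
      sumFin v (λ x → occ A x C 2 + 1)     ≡⟨ sum-cong (λ x → uncurry C2-on-[1,2] (occ∈[1,2] x)) ⟩
      sumFin v (occ A)                     ≡⟨ sum-occ A ⟩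
      r * c                                ≤⟨ rc≤v+c₂ ⟩
      v + c C 2                            ≡⟨ +-comm v _ ⟩
      c C 2 + v                            ≡⟨ cong₂ _+_ (*-identityˡ _) (*-identityʳ v) ⟨
      1 * (c C 2) + v * 1                  ∎)

  module Freshened (p q : Fin r) (p<q : toℕ p < toℕ q)
                   (maximal : ∀ i i′ → toℕ i < toℕ i′ → ∣ Row i ∩ Row i′ ∣ ≤ ∣ Row p ∩ Row q ∣)
                   (k : Fin c) (s∈Row-p : A q k ∈ Row p) where

    open Freshen A q k

    B : Design r c (suc v)
    B = freshen A q k

    private
      s : Fin v
      s = A q k
      Row′ : Fin r → Subset (suc v)
      Row′ = rowSet B
      Col′ : Fin c → Subset (suc v)
      Col′ = colSet B

    p≢q : p ≢ q
    p≢q p≡q = <-irrefl (cong toℕ p≡q) p<q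

    s∈Row-q : s ∈ Row q
    s∈Row-q = ∈-image⁺ (A q) k

    s∈Col-k : s ∈ Col k
    s∈Col-k = ∈-image⁺ (λ i → A i k) q

    s-only-in-rows-p-q : ∀ {i} → s ∈ Row i → i ≢ p → i ≢ q → ⊥
    s-only-in-rows-p-q {i} s∈Row-i i≢p i≢q = <⇒≱ 2<occ-s (proj₂ (occ∈[1,2] s))
      where
      three-rows : 3 ≤ rowCount A p s + rowCount A q s + rowCount A i s
      three-rows = +-mono-≤ (+-mono-≤ (∈-rowSet⇒0<rowCount A s∈Row-p) (∈-rowSet⇒0<rowCount A s∈Row-q))
                            (∈-rowSet⇒0<rowCount A s∈Row-i)
      2<occ-s : 2 < occ A s
      2<occ-s = ≤-trans three-rows (three-terms≤sum (λ i → rowCount A i s) p≢q (i≢p ∘ sym) (i≢q ∘ sym))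

    occ′∈[1,2] : ∀ t → 1 ≤ occ B t × occ B t ≤ 2
    occ′∈[1,2] zero    = subst (λ n → 1 ≤ n × n ≤ 2) (sym occ-freshen-zero) (≤-refl , s≤s z≤n)
    occ′∈[1,2] (suc x) = occurs (x ≟ s) , ≤-trans (occ-freshen-suc x) (proj₂ (occ∈[1,2] x))
      where
      occurs : Dec (x ≡ s) → 0 < occ B (suc x)
      occurs (yes x≡s) = let (j , Apj≡s) = ∈-image⁻ (A p) s∈Row-p in
        occ-freshen-positive (trans Apj≡s (sym x≡s)) (inj₁ p≢q)
      occurs (no  x≢s) = let (i , j , Aij≡x) = occ-positive⇒cell A (proj₁ (occ∈[1,2] x)) in
        occ-freshen-positive Aij≡x (not-fresh-cell (i ≟ q) Aij≡x)
        where
        not-fresh-cell : ∀ {i j} → Dec (i ≡ q) → A i j ≡ x → i ≢ q ⊎ j ≢ k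
        not-fresh-cell (no  i≢q) _     = inj₁ i≢q
        not-fresh-cell (yes refl) Aqj≡x = inj₂ (λ { refl → x≢s (sym Aqj≡x) })

    occ≈′ : ∀ t → FloorOrCeil (r * c) (suc v) (occ B t)
    occ≈′ t = subst (λ S → FloorOrCeil S (suc v) (occ B t)) (sum-occ B)
                    (FloorOrCeil-sumFin (occ B) 1 occ′∈[1,2] t)

    row′∩col′≤row∩col : ∀ i j → Dec (i ≡ q) → Dec (j ≡ k) → ∣ Row′ i ∩ Col′ j ∣ ≤ ∣ Row i ∩ Col j ∣
    row′∩col′≤row∩col i j (yes refl) (yes refl) = begin
      ∣ Row′ q ∩ Col′ k ∣
        ≡⟨ cong₂ (λ X Y → ∣ X ∩ Y ∣) (rowSet-freshen bin) (colSet-freshen bin) ⟩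
      suc ∣ (Row q - s) ∩ (Col k - s) ∣
        ≤⟨ s≤s (∣p∩[q-x]∣≤∣p∩q∣ (Row q - s) (Col k) s) ⟩
      suc ∣ (Row q - s) ∩ Col k ∣
        ≡⟨ cong (suc ∘ ∣_∣) ([p-x]∩q≡p∩q-x (Row q) (Col k) s) ⟩
      suc ∣ Row q ∩ Col k - s ∣
        ≡⟨ x∈p⇒1+∣p-x∣≡∣p∣ (x∈p∩q⁺ (s∈Row-q , s∈Col-k)) ⟩
      ∣ Row q ∩ Col k ∣ ∎
      where open ≤-Reasoning
    row′∩col′≤row∩col i j (yes refl) (no j≢k) = begin
      ∣ Row′ q ∩ Col′ j ∣
        ≡⟨ cong₂ (λ X Y → ∣ X ∩ Y ∣) (rowSet-freshen bin) (colSet-freshen-≢ j≢k) ⟩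
      ∣ (Row q - s) ∩ Col j ∣
        ≤⟨ ∣[p-x]∩q∣≤∣p∩q∣ (Row q) (Col j) s ⟩
      ∣ Row q ∩ Col j ∣ ∎
      where open ≤-Reasoning
    row′∩col′≤row∩col i j (no i≢q) (yes refl) = begin
      ∣ Row′ i ∩ Col′ k ∣
        ≡⟨ cong₂ (λ X Y → ∣ X ∩ Y ∣) (rowSet-freshen-≢ i≢q) (colSet-freshen bin) ⟩
      ∣ Row i ∩ (Col k - s) ∣
        ≤⟨ ∣p∩[q-x]∣≤∣p∩q∣ (Row i) (Col k) s ⟩
      ∣ Row i ∩ Col k ∣ ∎
      where open ≤-Reasoning
    row′∩col′≤row∩col i j (no i≢q) (no j≢k) =
      ≤-reflexive (cong₂ (λ X Y → ∣ X ∩ Y ∣) (rowSet-freshen-≢ i≢q) (colSet-freshen-≢ j≢k))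

    rc≈′ : ∀ i j → FloorOrCeil (Src B) (r * c) ∣ Row′ i ∩ Col′ j ∣
    rc≈′ = FloorOrCeil-sumGrid (λ i j → ∣ Row′ i ∩ Col′ j ∣) 1 λ i j →
      0<∣row∩col∣ B i j , ≤-trans (row′∩col′≤row∩col i j (i ≟ q) (j ≟ k)) (row∩col≤2 i j)

    col′∩col′≤col∩col : ∀ j j′ → j ≢ j′ → Dec (j ≡ k) → Dec (j′ ≡ k) →
                        ∣ Col′ j ∩ Col′ j′ ∣ ≤ ∣ Col j ∩ Col j′ ∣
    col′∩col′≤col∩col j j′ j≢j′ (yes refl) (yes refl) = contradiction refl j≢j′
    col′∩col′≤col∩col j j′ j≢j′ (yes refl) (no j′≢k) = begin
      ∣ Col′ k ∩ Col′ j′ ∣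
        ≡⟨ cong₂ (λ X Y → ∣ X ∩ Y ∣) (colSet-freshen bin) (colSet-freshen-≢ j′≢k) ⟩
      ∣ (Col k - s) ∩ Col j′ ∣
        ≤⟨ ∣[p-x]∩q∣≤∣p∩q∣ (Col k) (Col j′) s ⟩
      ∣ Col k ∩ Col j′ ∣ ∎
      where open ≤-Reasoning
    col′∩col′≤col∩col j j′ j≢j′ (no j≢k) (yes refl) = begin
      ∣ Col′ j ∩ Col′ k ∣
        ≡⟨ cong₂ (λ X Y → ∣ X ∩ Y ∣) (colSet-freshen-≢ j≢k) (colSet-freshen bin) ⟩
      ∣ Col j ∩ (Col k - s) ∣
        ≤⟨ ∣p∩[q-x]∣≤∣p∩q∣ (Col j) (Col k) s ⟩
      ∣ Col j ∩ Col k ∣ ∎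
      where open ≤-Reasoning
    col′∩col′≤col∩col j j′ j≢j′ (no j≢k) (no j′≢k) =
      ≤-reflexive (cong₂ (λ X Y → ∣ X ∩ Y ∣) (colSet-freshen-≢ j≢k) (colSet-freshen-≢ j′≢k))

    cc≈′ : ∀ j j′ → toℕ j < toℕ j′ → FloorOrCeil (Scc B) (c C 2) ∣ Col′ j ∩ Col′ j′ ∣
    cc≈′ = FloorOrCeil-sumPairs (λ j j′ → ∣ Col′ j ∩ Col′ j′ ∣) 0 λ j j′ j<j′ →
      z≤n , ≤-trans (col′∩col′≤col∩col j j′ (λ { refl → <-irrefl refl j<j′ }) (j ≟ k) (j′ ≟ k))
                    (col∩col≤1 j j′ j<j′)

    suc-row′p∩row′q : suc ∣ Row′ p ∩ Row′ q ∣ ≡ ∣ Row p ∩ Row q ∣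
    suc-row′p∩row′q = begin
      suc ∣ Row′ p ∩ Row′ q ∣
        ≡⟨ cong₂ (λ X Y → suc ∣ X ∩ Y ∣) (rowSet-freshen-≢ p≢q) (rowSet-freshen bin) ⟩
      suc ∣ Row p ∩ (Row q - s) ∣
        ≡⟨ cong (suc ∘ ∣_∣) (p∩[q-x]≡p∩q-x (Row p) (Row q) s) ⟩
      suc ∣ Row p ∩ Row q - s ∣
        ≡⟨ x∈p⇒1+∣p-x∣≡∣p∣ (x∈p∩q⁺ (s∈Row-p , s∈Row-q)) ⟩
      ∣ Row p ∩ Row q ∣ ∎
      where open ≡-Reasoning

    row′∩row′≡row∩row : ∀ i i′ → toℕ i < toℕ i′ → ¬ (i ≡ p × i′ ≡ q) → Dec (i ≡ q) → Dec (i′ ≡ q) →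
                        ∣ Row′ i ∩ Row′ i′ ∣ ≡ ∣ Row i ∩ Row i′ ∣
    row′∩row′≡row∩row i i′ i<i′ _ (yes refl) (yes refl) = contradiction i<i′ (<-irrefl refl)
    row′∩row′≡row∩row i i′ i<i′ _ (yes refl) (no i′≢q) = begin
      ∣ Row′ q ∩ Row′ i′ ∣
        ≡⟨ cong₂ (λ X Y → ∣ X ∩ Y ∣) (rowSet-freshen bin) (rowSet-freshen-≢ i′≢q) ⟩
      ∣ (Row q - s) ∩ Row i′ ∣
        ≡⟨ cong ∣_∣ ([p-x]∩q≡p∩q-x (Row q) (Row i′) s) ⟩
      ∣ Row q ∩ Row i′ - s ∣
        ≡⟨ cong ∣_∣ (x∉p⇒p-x≡p λ s∈ → s-only-in-rows-p-q (proj₂ (x∈p∩q⁻ (Row q) _ s∈)) i′≢p i′≢q) ⟩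
      ∣ Row q ∩ Row i′ ∣ ∎
      where
      open ≡-Reasoning
      i′≢p : i′ ≢ p
      i′≢p refl = <-asym p<q i<i′
    row′∩row′≡row∩row i i′ i<i′ ¬pq (no i≢q) (yes refl) = begin
      ∣ Row′ i ∩ Row′ q ∣
        ≡⟨ cong₂ (λ X Y → ∣ X ∩ Y ∣) (rowSet-freshen-≢ i≢q) (rowSet-freshen bin) ⟩
      ∣ Row i ∩ (Row q - s) ∣
        ≡⟨ cong ∣_∣ (p∩[q-x]≡p∩q-x (Row i) (Row q) s) ⟩
      ∣ Row i ∩ Row q - s ∣
        ≡⟨ cong ∣_∣ (x∉p⇒p-x≡p λ s∈ → s-only-in-rows-p-q (proj₁ (x∈p∩q⁻ (Row i) _ s∈)) i≢p i≢q) ⟩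
      ∣ Row i ∩ Row q ∣ ∎
      where
      open ≡-Reasoning
      i≢p : i ≢ p
      i≢p i≡p = ¬pq (i≡p , refl)
    row′∩row′≡row∩row i i′ i<i′ _ (no i≢q) (no i′≢q) =
      cong₂ (λ X Y → ∣ X ∩ Y ∣) (rowSet-freshen-≢ i≢q) (rowSet-freshen-≢ i′≢q)

    private
      a : ℕ
      a = ∣ Row′ p ∩ Row′ q ∣

    unchanged-near : ∀ i i′ → toℕ i < toℕ i′ → ¬ (i ≡ p × i′ ≡ q) →
                     a ≤ ∣ Row′ i ∩ Row′ i′ ∣ × ∣ Row′ i ∩ Row′ i′ ∣ ≤ suc a
    unchanged-near i i′ i<i′ ¬pq = subst (λ n → a ≤ n × n ≤ suc a)
      (sym (row′∩row′≡row∩row i i′ i<i′ ¬pq (i ≟ q) (i′ ≟ q)))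
      ( ≤-pred (subst (_≤ suc ∣ Row i ∩ Row i′ ∣) (sym suc-row′p∩row′q)
                      (FloorOrCeil-close (rr≈ p q p<q) (rr≈ i i′ i<i′)))
      , subst (∣ Row i ∩ Row i′ ∣ ≤_) (sym suc-row′p∩row′q) (maximal i i′ i<i′) )

    row′∩row′-near : ∀ i i′ → toℕ i < toℕ i′ → Dec (i ≡ p) → Dec (i′ ≡ q) →
                     a ≤ ∣ Row′ i ∩ Row′ i′ ∣ × ∣ Row′ i ∩ Row′ i′ ∣ ≤ suc a
    row′∩row′-near i i′ i<i′ (yes refl) (yes refl) = ≤-refl , n≤1+n a
    row′∩row′-near i i′ i<i′ (yes _)    (no i′≢q)  = unchanged-near i i′ i<i′ (i′≢q ∘ proj₂)
    row′∩row′-near i i′ i<i′ (no i≢p)   _          = unchanged-near i i′ i<i′ (i≢p ∘ proj₁)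

    rr≈′ : ∀ i i′ → toℕ i < toℕ i′ → FloorOrCeil (Srr B) (r C 2) ∣ Row′ i ∩ Row′ i′ ∣
    rr≈′ = FloorOrCeil-sumPairs (λ i i′ → ∣ Row′ i ∩ Row′ i′ ∣) a λ i i′ i<i′ →
      row′∩row′-near i i′ i<i′ (i ≟ p) (i′ ≟ q)

    isNearTripleArray : 2 ≤ r → 2 ≤ c → IsNearTripleArray B
    isNearTripleArray r≥2 c≥2 = r≥2 , c≥2 , freshen-binary bin , occ≈′ , rc≈′ , rr≈′ , cc≈′

  step : 2 ≤ r → 2 ≤ c → NearTripleArray r c (suc v)
  step r≥2 c≥2
    with (i , i′) , i<i′ , 0<Row-i∩Row-i′ ← rows-sharing A bin v<rc
    with (p , q) , p<q , maximal ← maximal-pair (λ i i′ → ∣ Row i ∩ Row i′ ∣) i<i′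
    with s , s∈Row-p∩Row-q ← 0<∣p∣⇒Nonempty (<-≤-trans 0<Row-i∩Row-i′ (maximal i i′ i<i′))
    with s∈Row-p , s∈Row-q ← x∈p∩q⁻ (Row p) (Row q) s∈Row-p∩Row-q
    with k , refl ← ∈-image⁻ (A q) s∈Row-q
    = freshen A q k , Freshened.isNearTripleArray p q p<q maximal k s∈Row-p r≥2 c≥2

near-triple-array-step : ∀ {r c v} → NearTripleArray r c v →
                         2 * (r * c) ≤ 2 * v + c * (r ⊓ (c ∸ 1)) → v < r * c →
                         NearTripleArray r c (suc v)
near-triple-array-step {r} {c} {v} (A , r≥2 , c≥2 , bin , occ≈ , rc≈ , rr≈ , cc≈) hyp v<rc =
  Step.step A bin occ≈ rc≈ rr≈ cc≈ v<rc rc≤2v rc≤v+c₂ r≥2 c≥2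
  where
  open ≤-Reasoning
  rc≤2v : r * c ≤ 2 * v
  rc≤2v = +-cancelʳ-≤ (r * c) _ _ (begin
    r * c + r * c                ≡⟨ cong (r * c +_) (+-identityʳ (r * c)) ⟨
    2 * (r * c)                  ≤⟨ hyp ⟩
    2 * v + c * (r ⊓ (c ∸ 1))    ≤⟨ +-monoʳ-≤ (2 * v) (*-monoʳ-≤ c (m⊓n≤m r (c ∸ 1))) ⟩
    2 * v + c * r                ≡⟨ cong (2 * v +_) (*-comm c r) ⟩
    2 * v + r * c                ∎)
  rc≤v+c₂ : r * c ≤ v + c C 2
  rc≤v+c₂ = *-cancelˡ-≤ 2 (begin
    2 * (r * c)                  ≤⟨ hyp ⟩
    2 * v + c * (r ⊓ (c ∸ 1))    ≤⟨ +-monoʳ-≤ (2 * v) (*-monoʳ-≤ c (m⊓n≤n r (c ∸ 1))) ⟩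
    2 * v + c * (c ∸ 1)          ≡⟨ cong (2 * v +_) (double-C2 c) ⟨
    2 * v + 2 * (c C 2)          ≡⟨ *-distribˡ-+ 2 v (c C 2) ⟨
    2 * (v + c C 2)              ∎)

near-triple-array-extend : ∀ {r c v} t → NearTripleArray r c v →
                           2 * (r * c) ≤ 2 * v + c * (r ⊓ (c ∸ 1)) → t ≤ r * c ∸ v →
                           NearTripleArray r c (v + t)
near-triple-array-extend {r} {c} {v} zero    T hyp _ = subst (NearTripleArray r c) (sym (+-identityʳ v)) T
near-triple-array-extend {r} {c} {v} (suc t) T hyp 1+t≤rc-v =
  subst (NearTripleArray r c) (sym (+-suc v t))
    (near-triple-array-extend t (near-triple-array-step T hyp v<rc) hyp′ t≤rc-[1+v])
  where
  v<rc : v < r * c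
  v<rc = m∸n≢0⇒n<m λ rc-v≡0 → contradiction (subst (suc t ≤_) rc-v≡0 1+t≤rc-v) λ ()
  hyp′ : 2 * (r * c) ≤ 2 * suc v + c * (r ⊓ (c ∸ 1))
  hyp′ = ≤-trans hyp (+-monoˡ-≤ _ (*-monoʳ-≤ 2 (n≤1+n v)))
  t≤rc-[1+v] : t ≤ r * c ∸ suc v
  t≤rc-[1+v] = subst (t ≤_) (pred[m∸n]≡m∸[1+n] (r * c) v) (pred-mono-≤ 1+t≤rc-v)

lemma5p2 : (r c v : ℕ) → NearTripleArray r c v
           → 2 * (r * c) ≤ 2 * v + c * (r ⊓ (c ∸ 1))
           → (i : ℕ) → 0 < i → i ≤ r * c ∸ v
           → NearTripleArray r c (v + i)
lemma5p2 r c v T hyp i _ i≤rc-v = near-triple-array-extend i T hyp i≤rc-v
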